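{- Let $\mathcal D$ be a database schema, $\mathcal U$ a domain, $\mathcal N=\{1,\dots,n\}$ a set of agents, and let $P\in\mathcal D$ have arity $q$. Consider a functional dependency $\ell_1,\dots,\ell_k\mapsto \ell_{k+1},\dots,\ell_q$ for $P$. Let $F$ be a quota rule in which the quota for $P$ is a single number $q_P$ (the same for all tuples). Then $F$ lifts this functional dependency if and only if $q_P>\frac{n}{2}$.
   Context: A database schema $\mathcal D$ is a finite set of relation symbols, each $P$ with an arity $q\in\mathbb N$. Fix a countable domain $\mathcal U$. A $\mathcal D$-instance is a map $D$ assigning to each $P\in\mathcal D$ of arity $q$ a finite relation $D(P)\subseteq\mathcal U^{q}$; $\mathcal D(\mathcal U)$ denotes the set of all $\mathcal D$-instances. A profile is a tuple $\vec D=(D_1,\dots,D_n)\in\mathcal D(\mathcal U)^n$, and an aggregation procedure is a function $F:\mathcal D(\mathcal U)^n\to\mathcal D(\mathcal U)$. A quota rule is an aggregation procedure given by functions $q_P:\mathcal U^{q}\to\{0,1,\dots,n+1\}$ (one for each $P\in\mathcal D$) such that $\vec u\in F(\vec D)(P)$ iff $|\{i\in\mathcal N:\vec u\in D_i(P)\}|\ge q_P(\vec u)$. An instance $D$ satisfies the functional dependency $\ell_1,\dots,\ell_k\mapsto\ell_{k+1},\dots,\ell_q$ for $P$ iff for all $\vec u,\vec u'\in D(P)$, if $u_i=u'_i$ for all $i\le k$ then $u_i=u'_i$ for all $k<i\le q$. $F$ lifts a constraint if for every profile $\vec D$ such that every $D_i$ satisfies the constraint, $F(\vec D)$ also satisfies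 it. -}

module Defs where

open import Data.Nat using (ℕ; _≤_; _<_; _+_)
open import Data.Nat.Properties using () renaming (_≟_ to _≟ℕ_)
open import Data.Fin using (Fin; toℕ)
open import Data.Vec using (Vec; lookup)
open import Data.Vec.Properties using (≡-dec)
open import Data.List using (List; length; filter)
open import Data.List.Base using (allFin)
open import Data.Product using (_×_)
open import Relation.Binary.PropositionalEquality using (_≡_)
open import Relation.Binary.Definitions using (DecidableEquality)
open import Function.Bundles using (_⇔_)
import Data.List.Membership.DecPropositional as DecMem
open import Relation.Nullary using (Dec)

-- The domain U is fixed to be ℕ (a countably infinite domain).
-- A database schema: m relation symbols (Fin m), each with an arity.
record Schema : Set where
  field
    m  : ℕ
    ar : Fin m → ℕ
open Schema public

Tuple : ℕ → Set
Tuple q = Vec ℕ q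

_≟T_ : ∀ {q} → DecidableEquality (Tuple q)
_≟T_ = ≡-dec _≟ℕ_

Rel : ℕ → Set
Rel q = List (Tuple q)

_∈R_ : ∀ {q} → Tuple q → Rel q → Set
_∈R_ {q} = DecMem._∈_ (_≟T_ {q})

_∈R?_ : ∀ {q} (u : Tuple q) (R : Rel q) → Dec (u ∈R R)
_∈R?_ {q} = DecMem._∈?_ (_≟T_ {q})

Instance : Schema → Set
Instance 𝒟 = (P : Fin (m 𝒟)) → Rel (ar 𝒟 P)

Profile : Schema → ℕ → Set
Profile 𝒟 n = Fin n → Instance 𝒟

Aggregation : Schema → ℕ → Set
Aggregation 𝒟 n = Profile 𝒟 n → Instance 𝒟

support : ∀ {𝒟 n} → Profile 𝒟 n → (P : Fin (m 𝒟)) → Tuple (ar 𝒟 P) → ℕ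
support {𝒟} {n} Ds P u = length (filter (λ i → u ∈R? Ds i P) (allFin n))

Quotas : Schema → Set
Quotas 𝒟 = (P : Fin (m 𝒟)) → Tuple (ar 𝒟 P) → ℕ

IsQuotaRule : ∀ {𝒟 n} → Aggregation 𝒟 n → Quotas 𝒟 → Set
IsQuotaRule {𝒟} {n} F qt =
  ((P : Fin (m 𝒟)) (u : Tuple (ar 𝒟 P)) → qt P u ≤ n + 1) ×
  ((Ds : Profile 𝒟 n) (P : Fin (m 𝒟)) (u : Tuple (ar 𝒟 P)) →
     (u ∈R F Ds P) ⇔ (qt P u ≤ support Ds P u))

-- Functional dependency ℓ₁,…,ℓₖ ↦ ℓₖ₊₁,…,ℓ_q for a relation of arity q:
-- agreement on the first k positions forces agreement on the remaining ones.
SatisfiesFDRel : ∀ {q} → ℕ → Rel q → Set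
SatisfiesFDRel {q} k R =
  (u u' : Tuple q) → u ∈R R → u' ∈R R →
  ((i : Fin q) → toℕ i < k → lookup u i ≡ lookup u' i) →
  ((i : Fin q) → k ≤ toℕ i → lookup u i ≡ lookup u' i)

SatisfiesFD : ∀ {𝒟} → (P : Fin (m 𝒟)) → ℕ → Instance 𝒟 → Set
SatisfiesFD P k D = SatisfiesFDRel k (D P)

LiftsFD : ∀ {𝒟 n} → Aggregation 𝒟 n → (P : Fin (m 𝒟)) → ℕ → Set
LiftsFD {𝒟} {n} F P k =
  (Ds : Profile 𝒟 n) → ((i : Fin n) → SatisfiesFD P k (Ds i)) →
  SatisfiesFD P k (F Ds)

module Submission where

-- Each direction uses only one half of the quota rule.
-- * Sufficiency (majority-lifts): if every accepted tuple has support ≥ c and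
--   n < 2c, then two accepted tuples have supports summing to more than n, so
--   by a pigeonhole count (common-witness) some agent holds both; that agent's
--   instance satisfies the dependency, hence so do the two tuples.
-- * Necessity (minority-breaks): if every tuple with support ≥ c is accepted
--   and 2c ≤ n, let the first c agents hold only the all-zero tuple and the
--   others only a tuple that is zero below position k but 1 at position k.
--   Every agent's instance is a singleton, so satisfies the dependency, while
--   both tuples reach support c (count-prefix, count-suffix) and are accepted,
--   violating the dependency in the output (fd-violation).

open import Defs
open import Data.Nat using (ℕ; zero; suc; _<_; _≤_; _*_; _+_; _∸_; z≤n; s≤s; _<?_)
open import Data.Nat.Properties
open import Data.Fin using (Fin; toℕ; fromℕ<) renaming (zero to fzero; suc to fsuc)
open import Data.Fin.Properties using (toℕ-fromℕ<)
open import Data.Vec using (lookup; replicate) renaming (tabulate to tabulateᵛ)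
open import Data.Vec.Properties using (lookup-replicate; lookup∘tabulate)
open import Data.List using (List; []; _∷_; length; filter; tabulate; allFin)
open import Data.List.Properties using (length-tabulate)
open import Data.List.Relation.Unary.Any using (here; there)
open import Data.Product using (Σ; _×_; _,_)
open import Relation.Nullary using (Dec; yes; no; ¬_; contradiction)
open import Relation.Unary using (Decidable)
open import Relation.Binary.PropositionalEquality
open import Function.Bundles using (_⇔_; mk⇔; Equivalence)

count : ∀ {X : Set} {Q : X → Set} → Decidable Q → List X → ℕ
count Q? xs = length (filter Q? xs)

common-witness : ∀ {X : Set} {A B : X → Set} (A? : Decidable A) (B? : Decidable B)
  (xs : List X) → length xs < count A? xs + count B? xs → Σ X (λ x → A x × B x)
common-witness A? B? []       ()
common-witness A? B? (x ∷ xs) h with A? x | B? x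
... | yes a | yes b = x , a , b
... | yes _ | no  _ = common-witness A? B? xs (≤-pred h)
... | no  _ | yes _ = common-witness A? B? xs
                        (≤-pred (subst (suc (length xs) <_) (+-suc _ _) h))
... | no  _ | no  _ = common-witness A? B? xs (≤-trans (n≤1+n _) h)

count-prefix : ∀ {X : Set} {Q : X → Set} (Q? : Decidable Q) n (f : Fin n → X) c →
  c ≤ n → (∀ i → toℕ i < c → Q (f i)) → c ≤ count Q? (tabulate f)
count-prefix Q? n       f zero    _         _ = z≤n
count-prefix Q? (suc n) f (suc c) (s≤s c≤n) h with Q? (f fzero)
... | yes _ = s≤s (count-prefix Q? n (λ i → f (fsuc i)) c c≤n (λ i i<c → h (fsuc i) (s≤s i<c)))
... | no ¬q = contradiction (h fzero (s≤s z≤n)) ¬q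

count-suffix : ∀ {X : Set} {Q : X → Set} (Q? : Decidable Q) n (f : Fin n → X) c →
  (∀ i → c ≤ toℕ i → Q (f i)) → n ∸ c ≤ count Q? (tabulate f)
count-suffix Q? zero    f c       _ = ≤-reflexive (0∸n≡0 c)
count-suffix Q? (suc n) f zero    h with Q? (f fzero)
... | yes _ = s≤s (count-suffix Q? n (λ i → f (fsuc i)) zero (λ i _ → h (fsuc i) z≤n))
... | no ¬q = contradiction (h fzero z≤n) ¬q
count-suffix Q? (suc n) f (suc c) h with Q? (f fzero)
... | yes _ = m≤n⇒m≤1+n (count-suffix Q? n (λ i → f (fsuc i)) c (λ i c≤i → h (fsuc i) (s≤s c≤i)))
... | no  _ = count-suffix Q? n (λ i → f (fsuc i)) c (λ i c≤i → h (fsuc i) (s≤s c≤i))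

twice : ∀ c → 2 * c ≡ c + c
twice c = cong (c +_) (+-identityʳ c)

shared-agent : ∀ {𝒟 n} (Ds : Profile 𝒟 n) (P : Fin (m 𝒟)) (u v : Tuple (ar 𝒟 P)) →
  n < support Ds P u + support Ds P v → Σ (Fin n) (λ i → u ∈R Ds i P × v ∈R Ds i P)
shared-agent {n = n} Ds P u v n<s =
  common-witness (λ i → u ∈R? Ds i P) (λ i → v ∈R? Ds i P) (allFin n)
    (subst (_< support Ds P u + support Ds P v) (sym (length-tabulate (λ i → i))) n<s)

majority-lifts : ∀ {𝒟 n} (F : Aggregation 𝒟 n) (P : Fin (m 𝒟)) k c →
  (∀ Ds u → u ∈R F Ds P → c ≤ support Ds P u) → n < 2 * c → LiftsFD F P k
majority-lifts {n = n} F P k c supported n<2c Ds fds u v u∈F v∈F agree =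
  let (i , u∈Dᵢ , v∈Dᵢ) = shared-agent Ds P u v n<supports
  in fds i u v u∈Dᵢ v∈Dᵢ agree
  where
  n<supports : n < support Ds P u + support Ds P v
  n<supports = <-≤-trans (subst (n <_) (twice c) n<2c)
                         (+-mono-≤ (supported Ds u u∈F) (supported Ds v v∈F))

fd-violation : ∀ {q} k (R : Rel q) (u v : Tuple q) → u ∈R R → v ∈R R →
  (∀ i → toℕ i < k → lookup u i ≡ lookup v i) →
  (j : Fin q) → k ≤ toℕ j → lookup u j ≢ lookup v j → ¬ SatisfiesFDRel k R
fd-violation k R u v u∈R v∈R agree j k≤j differ fd = differ (fd u v u∈R v∈R agree j k≤j)

singleton-FD : ∀ {q} k (t : Tuple q) → SatisfiesFDRel k (t ∷ [])
singleton-FD k t u v (here refl) (here refl) _ _ _ = refl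
singleton-FD k t u v (here _)    (there ())  _ _ _
singleton-FD k t u v (there ())  _           _ _ _

-- The two conflicting tuples of arity r: all zeros, and the tuple whose j-th
-- entry is (j + 1) ∸ k, which is 0 below position k and 1 at position k.
zeros : ∀ r → Tuple r
zeros r = replicate r 0

step : ℕ → ∀ r → Tuple r
step k r = tabulateᵛ (λ j → suc (toℕ j) ∸ k)

zeros-step-agree : ∀ k r (i : Fin r) → toℕ i < k → lookup (zeros r) i ≡ lookup (step k r) i
zeros-step-agree k r i i<k = begin
  lookup (zeros r) i     ≡⟨ lookup-replicate i 0 ⟩
  0                      ≡⟨ sym (m≤n⇒m∸n≡0 i<k) ⟩
  suc (toℕ i) ∸ k        ≡⟨ sym (lookup∘tabulate (λ j → suc (toℕ j) ∸ k) i) ⟩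
  lookup (step k r) i    ∎
  where open ≡-Reasoning

zeros-step-differ : ∀ k r (k<r : k < r) →
  lookup (zeros r) (fromℕ< k<r) ≢ lookup (step k r) (fromℕ< k<r)
zeros-step-differ k r k<r eq = 0≢1+n (begin
  0                                   ≡⟨ sym (lookup-replicate (fromℕ< k<r) 0) ⟩
  lookup (zeros r) (fromℕ< k<r)       ≡⟨ eq ⟩
  lookup (step k r) (fromℕ< k<r)      ≡⟨ lookup∘tabulate (λ j → suc (toℕ j) ∸ k) (fromℕ< k<r) ⟩
  suc (toℕ (fromℕ< k<r)) ∸ k          ≡⟨ cong (λ x → suc x ∸ k) (toℕ-fromℕ< k<r) ⟩
  suc k ∸ k                           ≡⟨ m+n∸n≡m 1 k ⟩
  1                                   ∎)
  where open ≡-Reasoning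

ballot : ∀ {A : Set} {q} → Dec A → Tuple q → Tuple q → Rel q
ballot (yes _) u v = u ∷ []
ballot (no  _) u v = v ∷ []

ballot-FD : ∀ {A : Set} {q} k (d : Dec A) (u v : Tuple q) → SatisfiesFDRel k (ballot d u v)
ballot-FD k (yes _) u v = singleton-FD k u
ballot-FD k (no  _) u v = singleton-FD k v

ballot-yes : ∀ {A : Set} {q} (d : Dec A) (u v : Tuple q) → A → u ∈R ballot d u v
ballot-yes (yes _) u v _ = here refl
ballot-yes (no ¬a) u v a = contradiction a ¬a

ballot-no : ∀ {A : Set} {q} (d : Dec A) (u v : Tuple q) → ¬ A → v ∈R ballot d u v
ballot-no (yes a) u v ¬a = contradiction a ¬a
ballot-no (no  _) u v _  = here refl

split : ∀ 𝒟 n → ℕ → ℕ → Profile 𝒟 n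
split 𝒟 n k c i P = ballot (toℕ i <? c) (zeros (ar 𝒟 P)) (step k (ar 𝒟 P))

minority-breaks : ∀ {𝒟 n} (F : Aggregation 𝒟 n) (P : Fin (m 𝒟)) k c → k < ar 𝒟 P →
  (∀ Ds u → c ≤ support Ds P u → u ∈R F Ds P) → 2 * c ≤ n → ¬ LiftsFD F P k
minority-breaks {𝒟} {n} F P k c k<q accepted 2c≤n lifts =
  fd-violation k (F Ds P) (zeros q) (step k q) zeros∈F step∈F
    (zeros-step-agree k q) (fromℕ< k<q) (≤-reflexive (sym (toℕ-fromℕ< k<q)))
    (zeros-step-differ k q k<q)
    (lifts Ds (λ i → ballot-FD k (toℕ i <? c) (zeros q) (step k q)))
  where
  q = ar 𝒟 P
  Ds = split 𝒟 n k c
  c+c≤n : c + c ≤ n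
  c+c≤n = subst (_≤ n) (twice c) 2c≤n
  zeros∈F : zeros q ∈R F Ds P
  zeros∈F = accepted Ds (zeros q)
    (count-prefix (λ i → zeros q ∈R? Ds i P) n (λ i → i) c (m+n≤o⇒m≤o c c+c≤n)
      (λ i i<c → ballot-yes (toℕ i <? c) (zeros q) (step k q) i<c))
  c≤n∸c : c ≤ n ∸ c
  c≤n∸c = subst (_≤ n ∸ c) (m+n∸n≡m c c) (∸-monoˡ-≤ c c+c≤n)
  step∈F : step k q ∈R F Ds P
  step∈F = accepted Ds (step k q)
    (≤-trans c≤n∸c (count-suffix (λ i → step k q ∈R? Ds i P) n (λ i → i) c
      (λ i c≤i → ballot-no (toℕ i <? c) (zeros q) (step k q) (≤⇒≯ c≤i))))

proposition1 : (𝒟 : Schema) (n : ℕ) (P : Fin (m 𝒟)) (k : ℕ) → k < ar 𝒟 P →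
    (F : Aggregation 𝒟 n) (qt : Quotas 𝒟) (c : ℕ) →
    IsQuotaRule F qt → (∀ u → qt P u ≡ c) →
    LiftsFD F P k ⇔ (n < 2 * c)
proposition1 𝒟 n P k k<q F qt c (_ , quota) qt≡c =
  mk⇔ (λ lifts → ≰⇒> (λ 2c≤n → minority-breaks F P k c k<q accepted 2c≤n lifts))
      (majority-lifts F P k c supported)
  where
  supported : ∀ Ds u → u ∈R F Ds P → c ≤ support Ds P u
  supported Ds u u∈F = subst (_≤ support Ds P u) (qt≡c u) (Equivalence.to (quota Ds P u) u∈F)
  accepted : ∀ Ds u → c ≤ support Ds P u → u ∈R F Ds P
  accepted Ds u c≤s = Equivalence.from (quota Ds P u) (subst (_≤ support Ds P u) (sym (qt≡c u)) c≤s)
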